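{- Let $n,k \geq 1$ be natural numbers, and let $v_1,\dots,v_n$ be positive integers with $v_i \leq kn$ for all $i=1,\dots,n$, such that $\delta(v_1,\dots,v_n) < \frac{1}{n+1}$. Then: (i) for every $1 \leq j \leq n+1$, at least one of $v_1,\dots,v_n$ is a multiple of $j$; (ii) for every $1 \leq j \leq n$ and every integer $a$ coprime to $j$, there exists $i \in \{1,\dots,n\}$ such that either $v_i = cj$ for some $c \in \{1,\dots,k-1\}$, or else $v_i \equiv a \pmod j$ and $v_i > k(n+1-j)$.
   Context: For $t \in \mathbb{R}/\mathbb{Z}$, $\|t\|_{\mathbb{R}/\mathbb{Z}}$ denotes the distance from (any representative of) $t$ to the nearest integer. For non-zero integers $v_1,\dots,v_n$, $\delta(v_1,\dots,v_n)$ denotes the maximum over $t \in \mathbb{R}/\mathbb{Z}$ of $\min(\|tv_1\|_{\mathbb{R}/\mathbb{Z}},\dots,\|tv_n\|_{\mathbb{R}/\mathbb{Z}})$. -}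

module Defs where

open import Data.Nat using (ℕ; suc)
open import Data.Fin using (Fin)
open import Data.Integer using (ℤ; +_)
open import Data.Rational using (ℚ; floor; _/_; _-_; _+_; _*_; _⊓_; _≤_; _<_; 0ℚ; 1ℚ)
open import Data.Product using (Σ; ∃; _×_)

fracℚ : ℚ → ℚ
fracℚ x = x - (floor x / 1)

distℤ : ℚ → ℚ
distℤ x = fracℚ x ⊓ (1ℚ - fracℚ x)

-- Since t ↦ minᵢ ‖t vᵢ‖ is continuous on ℝ/ℤ and ℚ is dense,
-- δ(v) (a maximum over ℝ/ℤ) equals the supremum over rational t; hence
-- δ(v) < c  iff  there is a rational ε > 0 with minᵢ ‖t vᵢ‖ + ε ≤ c for all rational t.
-- "minᵢ ‖t vᵢ‖ + ε ≤ c" is written as "∃ i, ‖t vᵢ‖ + ε ≤ c".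
δ-below : ∀ {n} → (Fin n → ℕ) → ℚ → Set
δ-below {n} v c = Σ ℚ λ ε → (0ℚ < ε) × ((t : ℚ) → ∃ λ (i : Fin n) → distℤ (t * ((+ v i) / 1)) + ε ≤ c)

module Submission where

-- Test the hypothesis on δ at rational points t = P / N: for some i and integer z it gives
-- (n + 1) · |P vᵢ − z N| < N. For (i) take t = 1 / j; then |vᵢ − z j| < j / (n + 1) ≤ 1 forces
-- vᵢ = z j. For (ii) pick b with a b ≡ −1 (mod j), put K = k (n + 1) and t = (b K + 1) / (j K);
-- this gives |vᵢ + K w| < j k for w = b vᵢ − z j, and vᵢ + a w ≡ (a b + 1) vᵢ ≡ 0 (mod j).
-- Since 0 < vᵢ < K and j k ≤ K, only w = 0 (then j ∣ vᵢ < j k) or w = −1 (then vᵢ ≡ a (mod j)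
-- and vᵢ > K − j k) are possible.

open import Data.Empty using (⊥-elim)
open import Data.Fin using (Fin)
open import Data.Integer as ℤ using (ℤ; +_; -[1+_]; ∣_∣) renaming (_-_ to _-ℤ_)
import Data.Integer.DivMod as ℤ
open import Data.Integer.Divisibility using () renaming (_∣_ to _∣ℤ_)
open import Data.Integer.Divisibility.Signed using (divides; ∣⇒∣ᵤ) renaming (_∣_ to _∣ˢ_)
import Data.Integer.Properties as ℤₚ
open import Data.Integer.Tactic.RingSolver using (solve-∀)
open import Data.Nat as ℕ using (ℕ; suc; _+_; _*_; _∸_; _≤_; _<_)
open import Data.Nat.Coprimality using (Coprime; coprime-Bézout)
open import Data.Nat.Divisibility as ℕ∣ using (_∣_)
open import Data.Nat.GCD using (module Bézout)
import Data.Nat.Properties as ℕₚ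
open import Data.Product using (∃; _×_; _,_)
open import Data.Rational as ℚ using (mkℚ; toℚᵘ; 1ℚ; _/_)
import Data.Rational.Properties as ℚₚ
open import Data.Rational.Unnormalised as ℚᵘ using (mkℚᵘ; *≡*) renaming (_≃_ to _≃ᵘ_; _<_ to _<ᵘ_)
import Data.Rational.Unnormalised.Properties as ℚᵘₚ
open import Data.Sum as Sum using (_⊎_; inj₁; inj₂)
open import Relation.Binary.PropositionalEquality
  using (_≡_; refl; sym; trans; cong; cong₂; subst; subst₂; module ≡-Reasoning)

open import Defs

[+m]-[+n]≡+[m∸n] : ∀ {m n} → n ≤ m → + m ℤ.- + n ≡ + (m ∸ n)
[+m]-[+n]≡+[m∸n] {m} {n} n≤m = trans (ℤₚ.[+m]-[+n]≡m⊖n m n) (ℤₚ.⊖-≥ n≤m)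

p-[p/d]*d≡p%d : ∀ p d .{{_ : ℤ.NonZero d}} → p ℤ.- (p ℤ./ d) ℤ.* d ≡ + (p ℤ.% d)
p-[p/d]*d≡p%d p d = begin
  p ℤ.- (p ℤ./ d) ℤ.* d                             ≡⟨ cong (ℤ._- (p ℤ./ d) ℤ.* d) (ℤ.a≡a%n+[a/n]*n p d) ⟩
  + (p ℤ.% d) ℤ.+ (p ℤ./ d) ℤ.* d ℤ.- (p ℤ./ d) ℤ.* d ≡⟨ r+x-x≡r (+ (p ℤ.% d)) ((p ℤ./ d) ℤ.* d) ⟩
  + (p ℤ.% d)                                       ∎
  where
  open ≡-Reasoning
  r+x-x≡r : ∀ r x → r ℤ.+ x ℤ.- x ≡ r
  r+x-x≡r = solve-∀

p-[p/d+1]*d≡-[d-p%d] : ∀ p d .{{_ : ℕ.NonZero d}} →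
  p ℤ.- (p ℤ./ + d ℤ.+ + 1) ℤ.* + d ≡ ℤ.- + (d ∸ p ℤ.% + d)
p-[p/d+1]*d≡-[d-p%d] p d = begin
  p ℤ.- (p ℤ./ + d ℤ.+ + 1) ℤ.* + d       ≡⟨ shift-quotient p (p ℤ./ + d) (+ d) ⟩
  ℤ.- (+ d ℤ.- (p ℤ.- (p ℤ./ + d) ℤ.* + d)) ≡⟨ cong (λ r → ℤ.- (+ d ℤ.- r)) (p-[p/d]*d≡p%d p (+ d)) ⟩
  ℤ.- (+ d ℤ.- + (p ℤ.% + d))               ≡⟨ cong ℤ.-_ ([+m]-[+n]≡+[m∸n] (ℕₚ.<⇒≤ (ℤ.n%d<d p (+ d)))) ⟩
  ℤ.- + (d ∸ p ℤ.% + d)                     ∎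
  where
  open ≡-Reasoning
  shift-quotient : ∀ p f d → p ℤ.- (f ℤ.+ + 1) ℤ.* d ≡ ℤ.- (d ℤ.- (p ℤ.- f ℤ.* d))
  shift-quotient = solve-∀

toℚᵘ-/ : ∀ i d → toℚᵘ (i / suc d) ≃ᵘ mkℚᵘ i d
toℚᵘ-/ i d = ℚₚ.toℚᵘ-fromℚᵘ (mkℚᵘ i d)

e/d<1/m⇒m*e<d : ∀ {y e d} m → toℚᵘ y ≃ᵘ mkℚᵘ (+ e) d → y ℚ.< + 1 / suc m → suc m * e < suc d
e/d<1/m⇒m*e<d {y} {e} {d} m y≃e/d y<1/m = ℤₚ.drop‿+<+ (subst₂ ℤ._<_ e*m≡ 1*d≡ (ℚᵘₚ.drop-*<* e/d<1/m))
  where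
  e/d<1/m : mkℚᵘ (+ e) d <ᵘ mkℚᵘ (+ 1) m
  e/d<1/m = ℚᵘₚ.<-respʳ-≃ (toℚᵘ-/ (+ 1) m) (ℚᵘₚ.<-respˡ-≃ y≃e/d (ℚₚ.toℚᵘ-mono-< y<1/m))
  e*m≡ : + e ℤ.* + suc m ≡ + (suc m * e)
  e*m≡ = trans (sym (ℤₚ.pos-* e (suc m))) (cong +_ (ℕₚ.*-comm e (suc m)))
  1*d≡ : + 1 ℤ.* + suc d ≡ + suc d
  1*d≡ = ℤₚ.*-identityˡ (+ suc d)

toℚᵘ-fracℚ : ∀ p d .(c : Coprime ∣ p ∣ (suc d)) → toℚᵘ (fracℚ (mkℚ p d c)) ≃ᵘ mkℚᵘ (+ (p ℤ.% + suc d)) d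
toℚᵘ-fracℚ p d c = ℚᵘₚ.≃-trans toℚᵘ-x-f (*≡* (begin
    (p ℤ.* + 1 ℤ.+ ℤ.- f ℤ.* D) ℤ.* D        ≡⟨ cong (λ p → (p ℤ.* + 1 ℤ.+ ℤ.- f ℤ.* D) ℤ.* D) p≡r+fD ⟩
    ((r ℤ.+ f ℤ.* D) ℤ.* + 1 ℤ.+ ℤ.- f ℤ.* D) ℤ.* D ≡⟨ f-cancels r f D ⟩
    r ℤ.* (D ℤ.* + 1)                          ≡⟨ cong (r ℤ.*_) (ℤₚ.pos-* (suc d) 1) ⟨
    r ℤ.* + (suc d * 1)                         ∎))
  where
  open ≡-Reasoning
  D = + suc d
  f = p ℤ./ D
  r = + (p ℤ.% D)
  p≡r+fD : p ≡ r ℤ.+ f ℤ.* D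
  p≡r+fD = ℤ.a≡a%n+[a/n]*n p D
  f-cancels : ∀ r f D → ((r ℤ.+ f ℤ.* D) ℤ.* + 1 ℤ.+ ℤ.- f ℤ.* D) ℤ.* D ≡ r ℤ.* (D ℤ.* + 1)
  f-cancels = solve-∀
  toℚᵘ-x-f : toℚᵘ (fracℚ (mkℚ p d c)) ≃ᵘ mkℚᵘ p d ℚᵘ.+ ℚᵘ.- mkℚᵘ f 0
  toℚᵘ-x-f = ℚᵘₚ.≃-trans (ℚₚ.toℚᵘ-homo-+ (mkℚ p d c) (ℚ.- (f / 1)))
               (ℚᵘₚ.+-congʳ (mkℚᵘ p d) (ℚᵘₚ.≃-trans (ℚₚ.toℚᵘ-homo‿- (f / 1)) (ℚᵘₚ.-‿cong (toℚᵘ-/ f 0))))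

toℚᵘ-1- : ∀ y r d → r ≤ suc d → toℚᵘ y ≃ᵘ mkℚᵘ (+ r) d → toℚᵘ (1ℚ ℚ.- y) ≃ᵘ mkℚᵘ (+ (suc d ∸ r)) d
toℚᵘ-1- y r d r≤D y≃r/D = ℚᵘₚ.≃-trans toℚᵘ-1-y (*≡* (begin
    (+ 1 ℤ.* D ℤ.+ ℤ.- + r ℤ.* + 1) ℤ.* D ≡⟨ 1-r≡ D (+ r) ⟩
    (D ℤ.- + r) ℤ.* (+ 1 ℤ.* D)            ≡⟨ cong₂ ℤ._*_ ([+m]-[+n]≡+[m∸n] r≤D) (sym (ℤₚ.pos-* 1 (suc d))) ⟩
    + (suc d ∸ r) ℤ.* + (1 * suc d)         ∎))
  where
  open ≡-Reasoning
  D = + suc d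
  1-r≡ : ∀ D r → (+ 1 ℤ.* D ℤ.+ ℤ.- r ℤ.* + 1) ℤ.* D ≡ (D ℤ.- r) ℤ.* (+ 1 ℤ.* D)
  1-r≡ = solve-∀
  toℚᵘ-1-y : toℚᵘ (1ℚ ℚ.- y) ≃ᵘ mkℚᵘ (+ 1) 0 ℚᵘ.+ ℚᵘ.- mkℚᵘ (+ r) d
  toℚᵘ-1-y = ℚᵘₚ.≃-trans (ℚₚ.toℚᵘ-homo-+ 1ℚ (ℚ.- y))
               (ℚᵘₚ.+-congʳ (mkℚᵘ (+ 1) 0) (ℚᵘₚ.≃-trans (ℚₚ.toℚᵘ-homo‿- y) (ℚᵘₚ.-‿cong y≃r/D)))

toℚᵘ-/-* : ∀ P N v → toℚᵘ ((P / suc N) ℚ.* (+ v / 1)) ≃ᵘ mkℚᵘ (P ℤ.* + v) N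
toℚᵘ-/-* P N v = ℚᵘₚ.≃-trans (ℚₚ.toℚᵘ-homo-* (P / suc N) (+ v / 1))
  (ℚᵘₚ.≃-trans (ℚᵘₚ.*-cong (toℚᵘ-/ P N) (toℚᵘ-/ (+ v) 0))
    (*≡* (cong (λ n → P ℤ.* + v ℤ.* + n) (sym (ℕₚ.*-identityʳ (suc N))))))

NearMultiple : ℕ → ℕ → ℤ → Set
NearMultiple m d p = ∃ λ z → m * ∣ p ℤ.- z ℤ.* + d ∣ < d

fracℚ<1/⇒nearMultiple : ∀ m p d .(c : Coprime ∣ p ∣ (suc d)) →
  fracℚ (mkℚ p d c) ℚ.< + 1 / suc m → NearMultiple (suc m) (suc d) p
fracℚ<1/⇒nearMultiple m p d c F<1/m = p ℤ./ + suc d ,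
  subst (λ e → suc m * e < suc d) (cong ∣_∣ (sym (p-[p/d]*d≡p%d p (+ suc d))))
    (e/d<1/m⇒m*e<d m (toℚᵘ-fracℚ p d c) F<1/m)

1-fracℚ<1/⇒nearMultiple : ∀ m p d .(c : Coprime ∣ p ∣ (suc d)) →
  1ℚ ℚ.- fracℚ (mkℚ p d c) ℚ.< + 1 / suc m → NearMultiple (suc m) (suc d) p
1-fracℚ<1/⇒nearMultiple m p d c 1-F<1/m = p ℤ./ + suc d ℤ.+ + 1 ,
  subst (λ e → suc m * e < suc d) (sym ∣p-zD∣≡D-r)
    (e/d<1/m⇒m*e<d m (toℚᵘ-1- (fracℚ (mkℚ p d c)) r d r≤D (toℚᵘ-fracℚ p d c)) 1-F<1/m)
  where
  r = p ℤ.% + suc d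
  r≤D : r ≤ suc d
  r≤D = ℕₚ.<⇒≤ (ℤ.n%d<d p (+ suc d))
  ∣p-zD∣≡D-r : ∣ p ℤ.- (p ℤ./ + suc d ℤ.+ + 1) ℤ.* + suc d ∣ ≡ suc d ∸ r
  ∣p-zD∣≡D-r = trans (cong ∣_∣ (p-[p/d+1]*d≡-[d-p%d] p (suc d))) (ℤₚ.∣-i∣≡∣i∣ (+ (suc d ∸ r)))

distℤ<1/⇒nearMultiple : ∀ m p d .(c : Coprime ∣ p ∣ (suc d)) →
  distℤ (mkℚ p d c) ℚ.< + 1 / suc m → NearMultiple (suc m) (suc d) p
distℤ<1/⇒nearMultiple m p d c dist<1/m with ℚₚ.⊓-sel (fracℚ (mkℚ p d c)) (1ℚ ℚ.- fracℚ (mkℚ p d c))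
... | inj₁ dist≡F   = fracℚ<1/⇒nearMultiple m p d c (subst (ℚ._< + 1 / suc m) dist≡F dist<1/m)
... | inj₂ dist≡1-F = 1-fracℚ<1/⇒nearMultiple m p d c (subst (ℚ._< + 1 / suc m) dist≡1-F dist<1/m)

nearMultiple-rescale : ∀ {m d n p x} .{{_ : ℕ.NonZero n}} → p ℤ.* + n ≡ x ℤ.* + d →
  NearMultiple m d p → NearMultiple m n x
nearMultiple-rescale {m} {d} {n} {p} {x} pn≡xd (z , m∣p-zd∣<d) = z , ℕₚ.*-cancelʳ-< d _ _ (begin-strict
  m * ∣ x ℤ.- z ℤ.* + n ∣ * d   ≡⟨ ℕₚ.*-assoc m _ d ⟩
  m * (∣ x ℤ.- z ℤ.* + n ∣ * d) ≡⟨ cong (m *_) ∣p-zd∣n≡∣x-zn∣d ⟨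
  m * (∣ p ℤ.- z ℤ.* + d ∣ * n) ≡⟨ ℕₚ.*-assoc m _ n ⟨
  m * ∣ p ℤ.- z ℤ.* + d ∣ * n   <⟨ ℕₚ.*-monoˡ-< n m∣p-zd∣<d ⟩
  d * n                         ≡⟨ ℕₚ.*-comm d n ⟩
  n * d                         ∎)
  where
  [p-zd]n≡[x-zn]d : (p ℤ.- z ℤ.* + d) ℤ.* + n ≡ (x ℤ.- z ℤ.* + n) ℤ.* + d
  [p-zd]n≡[x-zn]d = begin
    (p ℤ.- z ℤ.* + d) ℤ.* + n         ≡⟨ expand p z (+ d) (+ n) ⟩
    p ℤ.* + n ℤ.- z ℤ.* + d ℤ.* + n   ≡⟨ cong (ℤ._- z ℤ.* + d ℤ.* + n) pn≡xd ⟩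
    x ℤ.* + d ℤ.- z ℤ.* + d ℤ.* + n   ≡⟨ factor x z (+ d) (+ n) ⟩
    (x ℤ.- z ℤ.* + n) ℤ.* + d         ∎
    where
    open ≡-Reasoning
    expand : ∀ p z d n → (p ℤ.- z ℤ.* d) ℤ.* n ≡ p ℤ.* n ℤ.- z ℤ.* d ℤ.* n
    expand = solve-∀
    factor : ∀ x z d n → x ℤ.* d ℤ.- z ℤ.* d ℤ.* n ≡ (x ℤ.- z ℤ.* n) ℤ.* d
    factor = solve-∀
  ∣p-zd∣n≡∣x-zn∣d : ∣ p ℤ.- z ℤ.* + d ∣ * n ≡ ∣ x ℤ.- z ℤ.* + n ∣ * d
  ∣p-zd∣n≡∣x-zn∣d = trans (sym (ℤₚ.abs-* (p ℤ.- z ℤ.* + d) (+ n)))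
    (trans (cong ∣_∣ [p-zd]n≡[x-zn]d) (ℤₚ.abs-* (x ℤ.- z ℤ.* + n) (+ d)))
  open ℕₚ.≤-Reasoning

toℚᵘ≃⇒nearMultiple : ∀ {x X} m d → toℚᵘ x ≃ᵘ mkℚᵘ X d →
  distℤ x ℚ.< + 1 / suc m → NearMultiple (suc m) (suc d) X
toℚᵘ≃⇒nearMultiple {mkℚ p e c} {X} m d x≃X/d dist<1/m =
  nearMultiple-rescale {suc m} {p = p} {x = X} (ℚᵘₚ.drop-*≡* x≃X/d) (distℤ<1/⇒nearMultiple m p e c dist<1/m)

distℤ[P/N*v]<1/⇒nearMultiple : ∀ m P N v .{{_ : ℕ.NonZero N}} →
  distℤ ((P / N) ℚ.* (+ v / 1)) ℚ.< + 1 / suc m → NearMultiple (suc m) N (P ℤ.* + v)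
distℤ[P/N*v]<1/⇒nearMultiple m P (suc N) v = toℚᵘ≃⇒nearMultiple m N (toℚᵘ-/-* P N v)

nearMultiple⇒∣ : ∀ {m d p} → d ≤ m → NearMultiple m d p → + d ∣ℤ p
nearMultiple⇒∣ {m} {d} {p} d≤m (z , m∣p-zd∣<d) =
  ∣⇒∣ᵤ (divides z (ℤₚ.i-j≡0⇒i≡j p (z ℤ.* + d) (ℤₚ.∣i∣≡0⇒i≡0 ∣p-zd∣≡0)))
  where
  m∣p-zd∣<m*1 : m * ∣ p ℤ.- z ℤ.* + d ∣ < m * 1
  m∣p-zd∣<m*1 = ℕₚ.<-≤-trans m∣p-zd∣<d (subst (d ≤_) (sym (ℕₚ.*-identityʳ m)) d≤m)
  ∣p-zd∣≡0 : ∣ p ℤ.- z ℤ.* + d ∣ ≡ 0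
  ∣p-zd∣≡0 = ℕₚ.n<1⇒n≡0 (ℕₚ.*-cancelˡ-< m _ 1 m∣p-zd∣<m*1)

∣+v+K*+e∣≡v+K*e : ∀ v K e → ∣ + v ℤ.+ + K ℤ.* + e ∣ ≡ v + K * e
∣+v+K*+e∣≡v+K*e v K e = cong (λ i → ∣ + v ℤ.+ i ∣) (sym (ℤₚ.pos-* K e))

∣+v+K*-[1+e]∣≡K*[1+e]∸v : ∀ {v} K e → v ≤ K * suc e → ∣ + v ℤ.+ + K ℤ.* -[1+ e ] ∣ ≡ K * suc e ∸ v
∣+v+K*-[1+e]∣≡K*[1+e]∸v {v} K e v≤K[1+e] = begin
  ∣ + v ℤ.+ + K ℤ.* -[1+ e ] ∣        ≡⟨ cong (λ i → ∣ + v ℤ.+ i ∣) K*-[1+e]≡-[K*[1+e]] ⟩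
  ∣ + v ℤ.- + (K * suc e) ∣            ≡⟨ cong ∣_∣ (ℤₚ.m-n≡m⊖n v (K * suc e)) ⟩
  ∣ v ℤ.⊖ K * suc e ∣                  ≡⟨ ℤₚ.∣⊖∣-≤ v≤K[1+e] ⟩
  K * suc e ∸ v                        ∎
  where
  open ≡-Reasoning
  K*-[1+e]≡-[K*[1+e]] : + K ℤ.* -[1+ e ] ≡ ℤ.- + (K * suc e)
  K*-[1+e]≡-[K*[1+e]] = trans (sym (ℤₚ.neg-distribʳ-* (+ K) (+ suc e))) (cong ℤ.-_ (sym (ℤₚ.pos-* K (suc e))))

∣v+K*w∣<J⇒w≡0⊎w≡-1 : ∀ {v K J} w → v < K → J ≤ K → ∣ + v ℤ.+ + K ℤ.* w ∣ < J →
  (w ≡ + 0 × v < J) ⊎ (w ≡ -[1+ 0 ] × K < v + J)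
∣v+K*w∣<J⇒w≡0⊎w≡-1 {v} {K} {J} (+ 0) _ _ ∣E∣<J =
  inj₁ (refl , ℕₚ.≤-<-trans (ℕₚ.m≤m+n v (K * 0)) (subst (_< J) (∣+v+K*+e∣≡v+K*e v K 0) ∣E∣<J))
∣v+K*w∣<J⇒w≡0⊎w≡-1 {v} {K} {J} (+ suc e) _ J≤K ∣E∣<J =
  ⊥-elim (ℕₚ.<⇒≱ (subst (_< J) (∣+v+K*+e∣≡v+K*e v K (suc e)) ∣E∣<J) J≤v+K[1+e])
  where
  J≤v+K[1+e] : J ≤ v + K * suc e
  J≤v+K[1+e] = ℕₚ.≤-trans J≤K (ℕₚ.≤-trans (ℕₚ.m≤m*n K (suc e)) (ℕₚ.m≤n+m (K * suc e) v))
∣v+K*w∣<J⇒w≡0⊎w≡-1 {v} {K} {J} -[1+ 0 ] v<K _ ∣E∣<J =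
  inj₂ (refl , ℕₚ.≤-<-trans (ℕₚ.m≤n+m∸n K v) (ℕₚ.+-monoʳ-< v K∸v<J))
  where
  K∸v<J : K ∸ v < J
  K∸v<J = subst (λ k → k ∸ v < J) (ℕₚ.*-identityʳ K)
    (subst (_< J) (∣+v+K*-[1+e]∣≡K*[1+e]∸v K 0 (subst (v ≤_) (sym (ℕₚ.*-identityʳ K)) (ℕₚ.<⇒≤ v<K))) ∣E∣<J)
∣v+K*w∣<J⇒w≡0⊎w≡-1 {v} {K} {J} -[1+ suc e ] v<K J≤K ∣E∣<J =
  ⊥-elim (ℕₚ.<⇒≱ (subst (_< J) (∣+v+K*-[1+e]∣≡K*[1+e]∸v K (suc e) v≤K[2+e]) ∣E∣<J) J≤K[2+e]∸v)
  where
  K+v≤K[2+e] : K + v ≤ K * suc (suc e)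
  K+v≤K[2+e] = subst (K + v ≤_) (sym (ℕₚ.*-suc K (suc e)))
    (ℕₚ.+-monoʳ-≤ K (ℕₚ.≤-trans (ℕₚ.<⇒≤ v<K) (ℕₚ.m≤m*n K (suc e))))
  v≤K[2+e] : v ≤ K * suc (suc e)
  v≤K[2+e] = ℕₚ.≤-trans (ℕₚ.m≤n+m v K) K+v≤K[2+e]
  J≤K[2+e]∸v : J ≤ K * suc (suc e) ∸ v
  J≤K[2+e]∸v = ℕₚ.≤-trans J≤K (ℕₚ.m+n≤o⇒m≤o∸n K K+v≤K[2+e])

pos-1+m*n≡o*p : ∀ m n o p → 1 + m * n ≡ o * p → + 1 ℤ.+ + m ℤ.* + n ≡ + o ℤ.* + p
pos-1+m*n≡o*p m n o p eq =
  trans (cong (ℤ._+_ (+ 1)) (sym (ℤₚ.pos-* m n))) (trans (cong +_ eq) (ℤₚ.pos-* o p))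

coprime⇒Ab+1≡qj : ∀ A j → Coprime A j → ∃ λ b → ∃ λ q → + A ℤ.* b ℤ.+ + 1 ≡ q ℤ.* + j
coprime⇒Ab+1≡qj A j A⊥j with coprime-Bézout A⊥j
... | Bézout.+- x y 1+yj≡xA = ℤ.- + x , ℤ.- + y , (begin
  + A ℤ.* ℤ.- + x ℤ.+ + 1         ≡⟨ swap (+ A) (+ x) ⟩
  + 1 ℤ.- + x ℤ.* + A             ≡⟨ cong (ℤ._-_ (+ 1)) (pos-1+m*n≡o*p y j x A 1+yj≡xA) ⟨
  + 1 ℤ.- (+ 1 ℤ.+ + y ℤ.* + j)   ≡⟨ cancel (+ y) (+ j) ⟩
  ℤ.- + y ℤ.* + j                 ∎)
  where
  open ≡-Reasoning
  swap : ∀ A x → A ℤ.* ℤ.- x ℤ.+ + 1 ≡ + 1 ℤ.- x ℤ.* A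
  swap = solve-∀
  cancel : ∀ y j → + 1 ℤ.- (+ 1 ℤ.+ y ℤ.* j) ≡ ℤ.- y ℤ.* j
  cancel = solve-∀
... | Bézout.-+ x y 1+xA≡yj = + x , + y , trans (swap (+ A) (+ x)) (pos-1+m*n≡o*p x A y j 1+xA≡yj)
  where
  swap : ∀ A x → A ℤ.* x ℤ.+ + 1 ≡ + 1 ℤ.+ x ℤ.* A
  swap = solve-∀

coprime⇒ab+1≡qj : ∀ a j → Coprime ∣ a ∣ j → ∃ λ b → ∃ λ q → a ℤ.* b ℤ.+ + 1 ≡ q ℤ.* + j
coprime⇒ab+1≡qj (+ A) j a⊥j = coprime⇒Ab+1≡qj A j a⊥j
coprime⇒ab+1≡qj -[1+ A ] j a⊥j with coprime⇒Ab+1≡qj (suc A) j a⊥j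
... | b , q , Ab+1≡qj = ℤ.- b , q , trans (cong (ℤ._+ + 1) (neg-neg (+ suc A) b)) Ab+1≡qj
  where
  neg-neg : ∀ a b → ℤ.- a ℤ.* ℤ.- b ≡ a ℤ.* b
  neg-neg = solve-∀

v+a[bv-zj]≡j[qv-az] : ∀ a b q j v z → a ℤ.* b ℤ.+ + 1 ≡ q ℤ.* j →
  v ℤ.+ a ℤ.* (b ℤ.* v ℤ.- z ℤ.* j) ≡ j ℤ.* (q ℤ.* v ℤ.- a ℤ.* z)
v+a[bv-zj]≡j[qv-az] a b q j v z ab+1≡qj = begin
  v ℤ.+ a ℤ.* (b ℤ.* v ℤ.- z ℤ.* j)        ≡⟨ expand a b j v z ⟩
  (a ℤ.* b ℤ.+ + 1) ℤ.* v ℤ.- a ℤ.* z ℤ.* j ≡⟨ cong (λ x → x ℤ.* v ℤ.- a ℤ.* z ℤ.* j) ab+1≡qj ⟩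
  q ℤ.* j ℤ.* v ℤ.- a ℤ.* z ℤ.* j           ≡⟨ factor q j v a z ⟩
  j ℤ.* (q ℤ.* v ℤ.- a ℤ.* z)               ∎
  where
  open ≡-Reasoning
  expand : ∀ a b j v z → v ℤ.+ a ℤ.* (b ℤ.* v ℤ.- z ℤ.* j) ≡ (a ℤ.* b ℤ.+ + 1) ℤ.* v ℤ.- a ℤ.* z ℤ.* j
  expand = solve-∀
  factor : ∀ q j v a z → q ℤ.* j ℤ.* v ℤ.- a ℤ.* z ℤ.* j ≡ j ℤ.* (q ℤ.* v ℤ.- a ℤ.* z)
  factor = solve-∀

k[1+n]<v+jk⇒k[n+1∸j]<v : ∀ {k n j v} → j ≤ suc n → k * suc n < v + j * k → k * (n + 1 ∸ j) < v
k[1+n]<v+jk⇒k[n+1∸j]<v {k} {n} {j} {v} j≤1+n K<v+jk =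
  ℕₚ.+-cancelʳ-< (j * k) (k * (n + 1 ∸ j)) v (subst (_< v + j * k) (sym k[n+1∸j]+jk≡K) K<v+jk)
  where
  open ≡-Reasoning
  k[n+1∸j]+jk≡K : k * (n + 1 ∸ j) + j * k ≡ k * suc n
  k[n+1∸j]+jk≡K = begin
    k * (n + 1 ∸ j) + j * k   ≡⟨ cong (λ m → k * (m ∸ j) + j * k) (ℕₚ.+-comm n 1) ⟩
    k * (suc n ∸ j) + j * k   ≡⟨ cong (_+_ (k * (suc n ∸ j))) (ℕₚ.*-comm j k) ⟩
    k * (suc n ∸ j) + k * j   ≡⟨ ℕₚ.*-distribˡ-+ k (suc n ∸ j) j ⟨
    k * (suc n ∸ j + j)       ≡⟨ cong (k *_) (ℕₚ.m∸n+n≡m j≤1+n) ⟩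
    k * suc n                 ∎

[bK+1]v-z[jK]≡v+K[bv-zj] : ∀ b K v z j →
  (b ℤ.* K ℤ.+ + 1) ℤ.* v ℤ.- z ℤ.* (j ℤ.* K) ≡ v ℤ.+ K ℤ.* (b ℤ.* v ℤ.- z ℤ.* j)
[bK+1]v-z[jK]≡v+K[bv-zj] = solve-∀

∣⇒smallMultiple : ∀ {j k v} → j ∣ v → 1 ≤ v → v < j * k → ∃ λ c → 1 ≤ c × c < k × v ≡ c * j
∣⇒smallMultiple {j} {k} (ℕ∣.divides c v≡cj) 1≤v v<jk =
  c , ℕₚ.*-cancelʳ-< j 0 c (subst (0 <_) v≡cj 1≤v) , ℕₚ.*-cancelʳ-< j c k (subst₂ _<_ v≡cj (ℕₚ.*-comm j k) v<jk) , v≡cj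

nearMultiple⇒multiple⊎residue : ∀ {n k j v} .{{_ : ℕ.NonZero k}} a b q → a ℤ.* b ℤ.+ + 1 ≡ q ℤ.* + j →
  1 ≤ v → v ≤ k * n → j ≤ n →
  NearMultiple (suc n) (j * (k * suc n)) ((b ℤ.* + (k * suc n) ℤ.+ + 1) ℤ.* + v) →
  (∃ λ c → 1 ≤ c × c < k × v ≡ c * j) ⊎ ((+ j ∣ℤ (+ v -ℤ a)) × k * (n + 1 ∸ j) < v)
nearMultiple⇒multiple⊎residue {n} {k} {j} {v} a b q ab+1≡qj 1≤v v≤kn j≤n (z , near) =
  Sum.map multiple residue (∣v+K*w∣<J⇒w≡0⊎w≡-1 w v<K jk≤K ∣v+Kw∣<jk)
  where
  K = k * suc n
  w = b ℤ.* + v ℤ.- z ℤ.* + j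

  v<K : v < K
  v<K = ℕₚ.≤-<-trans v≤kn (ℕₚ.*-monoʳ-< k (ℕₚ.n<1+n n))
  jk≤K : j * k ≤ K
  jk≤K = subst (_≤ K) (ℕₚ.*-comm k j) (ℕₚ.*-monoʳ-≤ k (ℕₚ.m≤n⇒m≤1+n j≤n))
  jK≡[1+n]jk : j * K ≡ suc n * (j * k)
  jK≡[1+n]jk = trans (sym (ℕₚ.*-assoc j k (suc n))) (ℕₚ.*-comm (j * k) (suc n))
  Pv-zjK≡v+Kw : (b ℤ.* + K ℤ.+ + 1) ℤ.* + v ℤ.- z ℤ.* + (j * K) ≡ + v ℤ.+ + K ℤ.* w
  Pv-zjK≡v+Kw = trans (cong (λ x → (b ℤ.* + K ℤ.+ + 1) ℤ.* + v ℤ.- z ℤ.* x) (ℤₚ.pos-* j K))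
    ([bK+1]v-z[jK]≡v+K[bv-zj] b (+ K) (+ v) z (+ j))
  ∣v+Kw∣<jk : ∣ + v ℤ.+ + K ℤ.* w ∣ < j * k
  ∣v+Kw∣<jk = ℕₚ.*-cancelˡ-< (suc n) _ _
    (subst₂ _<_ (cong (λ x → suc n * ∣ x ∣) Pv-zjK≡v+Kw) jK≡[1+n]jk near)

  j∣v+aw : + j ∣ˢ + v ℤ.+ a ℤ.* w
  j∣v+aw = divides (q ℤ.* + v ℤ.- a ℤ.* z)
    (trans (v+a[bv-zj]≡j[qv-az] a b q (+ j) (+ v) z ab+1≡qj) (ℤₚ.*-comm (+ j) _))

  multiple : w ≡ + 0 × v < j * k → ∃ λ c → 1 ≤ c × c < k × v ≡ c * j
  multiple (w≡0 , v<jk) = ∣⇒smallMultiple (∣⇒∣ᵤ j∣v) 1≤v v<jk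
    where
    v+a*0≡v : ∀ v a → v ℤ.+ a ℤ.* + 0 ≡ v
    v+a*0≡v = solve-∀
    j∣v : + j ∣ˢ + v
    j∣v = subst (+ j ∣ˢ_) (v+a*0≡v (+ v) a) (subst (λ w → + j ∣ˢ + v ℤ.+ a ℤ.* w) w≡0 j∣v+aw)

  residue : w ≡ -[1+ 0 ] × K < v + j * k → (+ j ∣ℤ (+ v -ℤ a)) × k * (n + 1 ∸ j) < v
  residue (w≡-1 , K<v+jk) = ∣⇒∣ᵤ j∣v-a , k[1+n]<v+jk⇒k[n+1∸j]<v (ℕₚ.m≤n⇒m≤1+n j≤n) K<v+jk
    where
    v+a*-1≡v-a : ∀ v a → v ℤ.+ a ℤ.* ℤ.- + 1 ≡ v ℤ.- a
    v+a*-1≡v-a = solve-∀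
    j∣v-a : + j ∣ˢ + v ℤ.- a
    j∣v-a = subst (+ j ∣ˢ_) (v+a*-1≡v-a (+ v) a) (subst (λ w → + j ∣ˢ + v ℤ.+ a ℤ.* w) w≡-1 j∣v+aw)

δ-below⇒dist< : ∀ {n} {v : Fin n → ℕ} {c} → δ-below v c →
  ∀ t → ∃ λ i → distℤ (t ℚ.* (+ v i / 1)) ℚ.< c
δ-below⇒dist< {v = v} (ε , 0<ε , dist+ε≤c) t with dist+ε≤c t
... | i , d+ε≤c = i , ℚₚ.<-≤-trans (subst (ℚ._< d ℚ.+ ε) (ℚₚ.+-identityʳ d) (ℚₚ.+-monoʳ-< d 0<ε)) d+ε≤c
  where
  d = distℤ (t ℚ.* (+ v i / 1))

∃vᵢ-multiple-of : ∀ n (v : Fin n → ℕ) → (∀ t → ∃ λ i → distℤ (t ℚ.* (+ v i / 1)) ℚ.< + 1 / suc n) →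
  (j : ℕ) → 1 ≤ j → j ≤ n + 1 → ∃ λ (i : Fin n) → j ∣ v i
∃vᵢ-multiple-of n v dist< (suc j) _ j≤n+1 with dist< (+ 1 / suc j)
... | i , d<1/[1+n] = i , subst (suc j ∣_) (cong ∣_∣ (ℤₚ.*-identityˡ (+ v i)))
  (nearMultiple⇒∣ {p = + 1 ℤ.* + v i} (subst (suc j ≤_) (ℕₚ.+-comm n 1) j≤n+1)
    (distℤ[P/N*v]<1/⇒nearMultiple n (+ 1) (suc j) (v i) d<1/[1+n]))

∃vᵢ-small-multiple⊎residue : ∀ n k → 1 ≤ k → (v : Fin n → ℕ) → (∀ i → 1 ≤ v i) → (∀ i → v i ≤ k * n) →
  (∀ t → ∃ λ i → distℤ (t ℚ.* (+ v i / 1)) ℚ.< + 1 / suc n) →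
  (j : ℕ) → 1 ≤ j → j ≤ n → (a : ℤ) → Coprime ∣ a ∣ j →
  ∃ λ (i : Fin n) → (∃ λ (c : ℕ) → 1 ≤ c × c < k × v i ≡ c * j) ⊎ ((+ j ∣ℤ (+ v i -ℤ a)) × k * (n + 1 ∸ j) < v i)
∃vᵢ-small-multiple⊎residue n k@(suc _) _ v 1≤v v≤kn dist< (suc j) _ j≤n a a⊥j
  with coprime⇒ab+1≡qj a (suc j) a⊥j
... | b , q , ab+1≡qj with dist< ((b ℤ.* + (k * suc n) ℤ.+ + 1) / (suc j * (k * suc n)))
... | i , d<1/[1+n] = i , nearMultiple⇒multiple⊎residue a b q ab+1≡qj (1≤v i) (v≤kn i) j≤n
  (distℤ[P/N*v]<1/⇒nearMultiple n (b ℤ.* + (k * suc n) ℤ.+ + 1) (suc j * (k * suc n)) (v i) d<1/[1+n])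

lemma5p1 : (n k : ℕ) → 1 ≤ n → 1 ≤ k → (v : Fin n → ℕ)
    → (∀ i → 1 ≤ v i) → (∀ i → v i ≤ k * n)
    → δ-below v (+ 1 / suc n)
    → ((j : ℕ) → 1 ≤ j → j ≤ n + 1 → ∃ λ (i : Fin n) → j ∣ v i)
      × ((j : ℕ) → 1 ≤ j → j ≤ n → (a : ℤ) → Coprime ∣ a ∣ j
         → ∃ λ (i : Fin n) →
             (∃ λ (c : ℕ) → 1 ≤ c × c < k × v i ≡ c * j)
             ⊎ ((+ j ∣ℤ (+ v i -ℤ a)) × k * (n + 1 ∸ j) < v i))
lemma5p1 n k _ 1≤k v 1≤v v≤kn δ<1/[1+n] =
  ∃vᵢ-multiple-of n v dist< , ∃vᵢ-small-multiple⊎residue n k 1≤k v 1≤v v≤kn dist<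
  where
  dist< = δ-below⇒dist< {v = v} δ<1/[1+n]
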